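{- Let $a,b$ be positive integers such that $a$ is coprime to $b$ and $a>b$. Then, as polynomials in the indeterminate $X$ with integer coefficients, $$X^{ab}-1 = (X^{a}-1)\Big(\sum_{i= 0}^{b-1}X^{i}\Big)\Big(1+(X-1)\sum_{i=0}^{b-1}\sum_{j=1}^{\lfloor ai/b\rfloor}X^{ai - bj}\Big).$$
   Context: $\lfloor x\rfloor$ denotes the floor of $x$; an inner sum whose upper limit is $0$ is empty (equal to $0$). -}

module Defs where

open import Algebra.Bundles using (CommutativeRing)
open import Data.Nat using (ℕ; zero; suc)

-- Polynomial identities over ℤ[X] are stated as identities holding for every
-- element x of every commutative ring R (equivalent, by the universal property
-- of ℤ[X]; in particular it applies to x = X in R = ℤ[X]).
module _ {c ℓ} (R : CommutativeRing c ℓ) where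
  open CommutativeRing R

  pow : Carrier → ℕ → Carrier
  pow x zero    = 1#
  pow x (suc n) = pow x n * x

  Σ< : ℕ → (ℕ → Carrier) → Carrier
  Σ< zero    f = 0#
  Σ< (suc n) f = Σ< n f + f n

-- Dividing x^n by x^b - 1 leaves the remainder x^(n mod b):
-- x^n = x^(n mod b) + (x^b - 1) Σ_{k < ⌊n/b⌋} x^(n - b(k+1)).  Take n = a i and sum
-- over i < b; as a is coprime to b, a i mod b runs through 0, …, b-1, so with
-- T = Σ_{i<b} x^i and S the double sum of the statement,
-- Σ_{i<b} x^(a i) = T + (x^b - 1) S.  Multiplying by x^a - 1 and using the geometric
-- sums (x - 1) T = x^b - 1 and (x^a - 1) Σ_{i<b} x^(a i) = x^(ab) - 1 gives
-- x^(ab) - 1 = (x^a - 1) T + (x^a - 1)(x - 1) T S, which is the claim.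
module Submission where

open import Defs
open import Algebra.Bundles using (CommutativeRing)
open import Data.Nat using (ℕ; suc; _<_; _∸_; >-nonZero) renaming (_*_ to _*ℕ_; _/_ to _/ℕ_)
open import Data.Nat.Coprimality using (Coprime)

open import Data.Nat using (zero; _≤_; _%_; NonZero) renaming (_+_ to _+ℕ_)
import Data.Nat.Properties as ℕ
open import Data.Nat.DivMod using (m≡m%n+[m/n]*n; m%n≡m∸m/n*n; m/n*n≤m; m%n<n; m<n⇒m%n≡m)
open import Data.Nat.Divisibility using (_∣_; divides; n∣m⇒m%n≡0)
open import Data.Nat.Coprimality using (coprime-divisor) renaming (sym to coprime-sym)
open import Data.Fin using (Fin; toℕ; fromℕ<; punchOut)
open import Data.Fin.Properties
  using (toℕ-fromℕ<; toℕ-injective; toℕ<n; any?; _≟_; punchOut-injective; <⇒notInjective)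
open import Data.Fin.Permutation using (Permutation′; permutation)
open import Data.Product using (_,_; proj₁; proj₂)
open import Function using (_∘_)
open import Function.Definitions using (Injective; StrictlySurjective)
open import Relation.Nullary using (yes; no)
open import Data.Empty using (⊥-elim)
open import Relation.Binary.PropositionalEquality as ≡ using (_≡_; _≢_; cong; cong₂)
import Algebra.Properties.CommutativeMonoid.Sum as MonoidSum
import Algebra.Properties.CommutativeSemigroup as CommSemigroupProperties
import Algebra.Properties.Group as GroupProperties
import Algebra.Properties.CommutativeSemiring.Exp as SemiringExp

injective⇒surjective : ∀ {n} {f : Fin n → Fin n} → Injective _≡_ _≡_ f → StrictlySurjective _≡_ f
injective⇒surjective {n} {f} f-inj v with any? (λ i → f i ≟ v)
... | yes hit = hit
injective⇒surjective {suc m} {f} f-inj v | no miss =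
  ⊥-elim (<⇒notInjective (ℕ.n<1+n m) squeeze-injective)
  where
  avoids : ∀ i → v ≢ f i
  avoids i v≡fi = miss (i , ≡.sym v≡fi)
  squeeze-injective : Injective _≡_ _≡_ (λ i → punchOut (avoids i))
  squeeze-injective {i} {j} eq = f-inj (punchOut-injective (avoids i) (avoids j) eq)

injective⇒permutation : ∀ {n} {f : Fin n → Fin n} → Injective _≡_ _≡_ f → Permutation′ n
injective⇒permutation {f = f} f-inj = permutation f (proj₁ ∘ surj) (proj₂ ∘ surj) (f-inj ∘ proj₂ ∘ surj ∘ f)
  where surj = injective⇒surjective f-inj

m%d≡n%d⇒d∣n∸m : ∀ m n d .{{_ : NonZero d}} → m % d ≡ n % d → d ∣ n ∸ m
m%d≡n%d⇒d∣n∸m m n d eq = divides (n /ℕ d ∸ m /ℕ d) (begin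
  n ∸ m                                           ≡⟨ cong₂ _∸_ n≡ (m≡m%n+[m/n]*n m d) ⟩
  (m % d +ℕ n /ℕ d *ℕ d) ∸ (m % d +ℕ m /ℕ d *ℕ d) ≡⟨ ℕ.[m+n]∸[m+o]≡n∸o (m % d) _ _ ⟩
  n /ℕ d *ℕ d ∸ m /ℕ d *ℕ d                       ≡⟨ ℕ.*-distribʳ-∸ d (n /ℕ d) (m /ℕ d) ⟨
  (n /ℕ d ∸ m /ℕ d) *ℕ d                          ∎)
  where
  open ≡.≡-Reasoning
  n≡ : n ≡ m % d +ℕ n /ℕ d *ℕ d
  n≡ = ≡.trans (m≡m%n+[m/n]*n n d) (cong (_+ℕ n /ℕ d *ℕ d) (≡.sym eq))

n∣m<n⇒m≡0 : ∀ {m n} .{{_ : NonZero n}} → n ∣ m → m < n → m ≡ 0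
n∣m<n⇒m≡0 {m} {n} n∣m m<n = ≡.trans (≡.sym (m<n⇒m%n≡m m<n)) (n∣m⇒m%n≡0 m n n∣m)

coprime⇒*-%-injective : ∀ {a b} .{{_ : NonZero b}} → Coprime a b →
  ∀ {i j} → i < b → j < b → (a *ℕ i) % b ≡ (a *ℕ j) % b → i ≡ j
coprime⇒*-%-injective {a} {b} cop i<b j<b eq = ℕ.≤-antisym (congruent⇒≤ (≡.sym eq) i<b) (congruent⇒≤ eq j<b)
  where
  congruent⇒≤ : ∀ {i j} → (a *ℕ i) % b ≡ (a *ℕ j) % b → j < b → j ≤ i
  congruent⇒≤ {i} {j} eq j<b = ℕ.m∸n≡0⇒m≤n (n∣m<n⇒m≡0 b∣j∸i (ℕ.≤-<-trans (ℕ.m∸n≤m j i) j<b))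
    where
    b∣j∸i : b ∣ j ∸ i
    b∣j∸i = coprime-divisor (coprime-sym cop)
      (≡.subst (b ∣_) (≡.sym (ℕ.*-distribˡ-∸ a j i)) (m%d≡n%d⇒d∣n∸m (a *ℕ i) (a *ℕ j) b eq))

module _ {c ℓ} (R : CommutativeRing c ℓ) where
  open CommutativeRing R
  open import Relation.Binary.Reasoning.Setoid setoid
  open MonoidSum +-commutativeMonoid using (sum; sum-permute; sum-cong-≗)
  open CommSemigroupProperties +-commutativeSemigroup using (interchange; x∙yz≈xz∙y)
  open CommSemigroupProperties *-commutativeSemigroup using (x∙yz≈yx∙z)
  open GroupProperties +-group using (//-rightDividesˡ; //-rightDividesʳ)
  open SemiringExp commutativeSemiring using (_^_; ^-congˡ; ^-homo-*; ^-assocʳ)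

  x+[y-x]≈y : ∀ x y → x + (y - x) ≈ y
  x+[y-x]≈y x y = trans (+-comm x (y - x)) (//-rightDividesˡ x y)

  x+y≈z⇒y≈z-x : ∀ {x y z} → x + y ≈ z → y ≈ z - x
  x+y≈z⇒y≈z-x {x} {y} {z} x+y≈z = begin
    y           ≈⟨ //-rightDividesʳ x y ⟨
    (y + x) - x ≈⟨ +-congʳ (trans (+-comm y x) x+y≈z) ⟩
    z - x       ∎

  x+[y-1]x≈yx : ∀ x y → x + (y - 1#) * x ≈ y * x
  x+[y-1]x≈yx x y = begin
    x + (y - 1#) * x      ≈⟨ +-congʳ (*-identityˡ x) ⟨
    1# * x + (y - 1#) * x ≈⟨ distribʳ x 1# (y - 1#) ⟨
    (1# + (y - 1#)) * x   ≈⟨ *-congʳ (x+[y-x]≈y 1# y) ⟩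
    y * x                 ∎

  pow≈^ : ∀ x n → pow R x n ≈ x ^ n
  pow≈^ x zero    = refl
  pow≈^ x (suc n) = trans (*-congʳ (pow≈^ x n)) (*-comm (x ^ n) x)

  pow-homo-* : ∀ x m n → pow R x (m +ℕ n) ≈ pow R x m * pow R x n
  pow-homo-* x m n = begin
    pow R x (m +ℕ n)          ≈⟨ pow≈^ x (m +ℕ n) ⟩
    x ^ (m +ℕ n)              ≈⟨ ^-homo-* x m n ⟩
    x ^ m * x ^ n             ≈⟨ *-cong (pow≈^ x m) (pow≈^ x n) ⟨
    pow R x m * pow R x n     ∎

  pow-assocʳ : ∀ x m n → pow R (pow R x m) n ≈ pow R x (m *ℕ n)
  pow-assocʳ x m n = begin
    pow R (pow R x m) n ≈⟨ pow≈^ (pow R x m) n ⟩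
    pow R x m ^ n       ≈⟨ ^-congˡ n (pow≈^ x m) ⟩
    (x ^ m) ^ n         ≈⟨ ^-assocʳ x m n ⟩
    x ^ (m *ℕ n)        ≈⟨ pow≈^ x (m *ℕ n) ⟨
    pow R x (m *ℕ n)    ∎

  Σ<-cong : ∀ n {f g : ℕ → Carrier} → (∀ i → f i ≈ g i) → Σ< R n f ≈ Σ< R n g
  Σ<-cong zero    f≈g = refl
  Σ<-cong (suc n) f≈g = +-cong (Σ<-cong n f≈g) (f≈g n)

  Σ<-distrib-+ : ∀ n (f g : ℕ → Carrier) → Σ< R n (λ i → f i + g i) ≈ Σ< R n f + Σ< R n g
  Σ<-distrib-+ zero    f g = sym (+-identityʳ 0#)
  Σ<-distrib-+ (suc n) f g = trans (+-congʳ (Σ<-distrib-+ n f g)) (interchange _ _ _ _)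

  *-distribˡ-Σ< : ∀ x n (f : ℕ → Carrier) → x * Σ< R n f ≈ Σ< R n (λ i → x * f i)
  *-distribˡ-Σ< x zero    f = zeroʳ x
  *-distribˡ-Σ< x (suc n) f = trans (distribˡ x _ _) (+-congʳ (*-distribˡ-Σ< x n f))

  Σ<-head : ∀ n (f : ℕ → Carrier) → Σ< R (suc n) f ≈ f 0 + Σ< R n (f ∘ suc)
  Σ<-head zero    f = trans (+-identityˡ (f 0)) (sym (+-identityʳ (f 0)))
  Σ<-head (suc n) f = trans (+-congʳ (Σ<-head n f)) (+-assoc _ _ _)

  Σ<≈sum : ∀ n (f : ℕ → Carrier) → Σ< R n f ≈ sum {n} (f ∘ toℕ)
  Σ<≈sum zero    f = refl
  Σ<≈sum (suc n) f = trans (Σ<-head n f) (+-congˡ (Σ<≈sum n (f ∘ suc)))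

  Σ<-reindex : ∀ n (f : ℕ → ℕ) (g : ℕ → Carrier) →
    (∀ {i} → i < n → f i < n) → (∀ {i j} → i < n → j < n → f i ≡ f j → i ≡ j) →
    Σ< R n (g ∘ f) ≈ Σ< R n g
  Σ<-reindex n f g f<n f-inj = begin
    Σ< R n (g ∘ f)        ≈⟨ Σ<≈sum n (g ∘ f) ⟩
    sum {n} (g ∘ f ∘ toℕ) ≡⟨ sum-cong-≗ (λ i → cong g (≡.sym (toℕ-fromℕ< (f<n (toℕ<n i))))) ⟩
    sum {n} (g ∘ toℕ ∘ F) ≈⟨ sum-permute (g ∘ toℕ) (injective⇒permutation F-injective) ⟨
    sum {n} (g ∘ toℕ)     ≈⟨ Σ<≈sum n g ⟨
    Σ< R n g              ∎
    where
    F : Fin n → Fin n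
    F i = fromℕ< (f<n (toℕ<n i))
    F-injective : Injective _≡_ _≡_ F
    F-injective {i} {j} Fi≡Fj = toℕ-injective (f-inj (toℕ<n i) (toℕ<n j)
      (≡.trans (≡.sym (toℕ-fromℕ< _)) (≡.trans (cong toℕ Fi≡Fj) (toℕ-fromℕ< _))))

  Σ<-geometric : ∀ {y} (g : ℕ → Carrier) → (∀ k → g (suc k) ≈ y * g k) →
    ∀ n → g 0 + (y - 1#) * Σ< R n g ≈ g n
  Σ<-geometric {y} g ratio zero = trans (+-congˡ (zeroʳ _)) (+-identityʳ (g 0))
  Σ<-geometric {y} g ratio (suc n) = begin
    g 0 + (y - 1#) * (Σ< R n g + g n)                ≈⟨ +-congˡ (distribˡ _ _ _) ⟩
    g 0 + ((y - 1#) * Σ< R n g + (y - 1#) * g n)     ≈⟨ +-assoc _ _ _ ⟨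
    (g 0 + (y - 1#) * Σ< R n g) + (y - 1#) * g n     ≈⟨ +-congʳ (Σ<-geometric g ratio n) ⟩
    g n + (y - 1#) * g n                             ≈⟨ x+[y-1]x≈yx (g n) y ⟩
    y * g n                                          ≈⟨ ratio n ⟨
    g (suc n)                                        ∎

  Σ<-geometric-descending : ∀ {y} (g : ℕ → Carrier) q → (∀ {k} → k < q → y * g (suc k) ≈ g k) →
    g q + (y - 1#) * Σ< R q (g ∘ suc) ≈ g 0
  Σ<-geometric-descending g zero ratio = trans (+-congˡ (zeroʳ _)) (+-identityʳ (g 0))
  Σ<-geometric-descending {y} g (suc q) ratio = begin
    g (suc q) + (y - 1#) * (S + g (suc q))               ≈⟨ +-congˡ (distribˡ _ _ _) ⟩
    g (suc q) + ((y - 1#) * S + (y - 1#) * g (suc q))   ≈⟨ x∙yz≈xz∙y _ _ _ ⟩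
    (g (suc q) + (y - 1#) * g (suc q)) + (y - 1#) * S   ≈⟨ +-congʳ (x+[y-1]x≈yx (g (suc q)) y) ⟩
    y * g (suc q) + (y - 1#) * S                        ≈⟨ +-congʳ (ratio (ℕ.n<1+n q)) ⟩
    g q + (y - 1#) * S                                  ≈⟨ Σ<-geometric-descending g q (ratio ∘ ℕ.m<n⇒m<1+n) ⟩
    g 0                                                 ∎
    where S = Σ< R q (g ∘ suc)

  geometric-sum : ∀ y n → (y - 1#) * Σ< R n (pow R y) ≈ pow R y n - 1#
  geometric-sum y n = x+y≈z⇒y≈z-x (Σ<-geometric (pow R y) (λ k → *-comm (pow R y k) y) n)

  x^n≈x^[n%b]+[x^b-1]*Σ : ∀ x b .{{_ : NonZero b}} n →
    pow R x (n % b) + (pow R x b - 1#) * Σ< R (n /ℕ b) (λ k → pow R x (n ∸ b *ℕ suc k)) ≈ pow R x n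
  x^n≈x^[n%b]+[x^b-1]*Σ x b n = begin
    pow R x (n % b) + (pow R x b - 1#) * Σ< R q (g ∘ suc) ≈⟨ +-congʳ (reflexive (cong (pow R x) n%b≡n∸b*q)) ⟩
    g q + (pow R x b - 1#) * Σ< R q (g ∘ suc)             ≈⟨ Σ<-geometric-descending g q ratio ⟩
    g 0                                                   ≡⟨ cong (λ m → pow R x (n ∸ m)) (ℕ.*-zeroʳ b) ⟩
    pow R x n                                             ∎
    where
    q = n /ℕ b
    g : ℕ → Carrier
    g k = pow R x (n ∸ b *ℕ k)
    n%b≡n∸b*q : n % b ≡ n ∸ b *ℕ q
    n%b≡n∸b*q = ≡.trans (m%n≡m∸m/n*n n b) (cong (n ∸_) (ℕ.*-comm q b))
    ratio : ∀ {k} → k < q → pow R x b * g (suc k) ≈ g k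
    ratio {k} k<q = begin
      pow R x b * g (suc k)               ≈⟨ pow-homo-* x b _ ⟨
      pow R x (b +ℕ (n ∸ b *ℕ suc k))     ≡⟨ cong (pow R x) (≡.sym (ℕ.+-∸-assoc b b[1+k]≤n)) ⟩
      pow R x ((b +ℕ n) ∸ b *ℕ suc k)     ≡⟨ cong (λ m → pow R x ((b +ℕ n) ∸ m)) (ℕ.*-suc b k) ⟩
      pow R x ((b +ℕ n) ∸ (b +ℕ b *ℕ k))  ≡⟨ cong (pow R x) (ℕ.[m+n]∸[m+o]≡n∸o b n (b *ℕ k)) ⟩
      g k                                 ∎
      where
      b[1+k]≤n : b *ℕ suc k ≤ n
      b[1+k]≤n = ℕ.≤-trans (ℕ.*-monoʳ-≤ b k<q) (≡.subst (_≤ n) (ℕ.*-comm q b) (m/n*n≤m n b))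

  x^ab-1-factorisation : ∀ x a b .{{_ : NonZero b}} → Coprime a b →
    pow R x (a *ℕ b) - 1#
      ≈ ((pow R x a - 1#) * Σ< R b (pow R x))
        * (1# + (x - 1#) * Σ< R b (λ i → Σ< R ((a *ℕ i) /ℕ b) (λ k → pow R x (a *ℕ i ∸ b *ℕ suc k))))
  x^ab-1-factorisation x a b cop = sym (begin
    (A * T) * (1# + (x - 1#) * S)            ≈⟨ distribˡ _ _ _ ⟩
    (A * T) * 1# + (A * T) * ((x - 1#) * S)  ≈⟨ +-cong (*-identityʳ _) (*-assoc A T _) ⟩
    A * T + A * (T * ((x - 1#) * S))         ≈⟨ +-congˡ (*-congˡ (x∙yz≈yx∙z T (x - 1#) S)) ⟩
    A * T + A * (((x - 1#) * T) * S)         ≈⟨ +-congˡ (*-congˡ (*-congʳ (geometric-sum x b))) ⟩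
    A * T + A * ((pow R x b - 1#) * S)       ≈⟨ distribˡ A _ _ ⟨
    A * (T + (pow R x b - 1#) * S)           ≈⟨ *-congˡ remainders ⟩
    A * Σ< R b (λ i → pow R x (a *ℕ i))       ≈⟨ *-congˡ (Σ<-cong b (pow-assocʳ x a)) ⟨
    A * Σ< R b (pow R (pow R x a))            ≈⟨ geometric-sum (pow R x a) b ⟩
    pow R (pow R x a) b - 1#                 ≈⟨ +-congʳ (pow-assocʳ x a b) ⟩
    pow R x (a *ℕ b) - 1#                    ∎)
    where
    A = pow R x a - 1#
    T = Σ< R b (pow R x)
    Sᵢ : ℕ → Carrier
    Sᵢ i = Σ< R ((a *ℕ i) /ℕ b) (λ k → pow R x (a *ℕ i ∸ b *ℕ suc k))
    S = Σ< R b Sᵢ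
    remainders : T + (pow R x b - 1#) * S ≈ Σ< R b (λ i → pow R x (a *ℕ i))
    remainders = begin
      T + (pow R x b - 1#) * S
        ≈⟨ +-cong (sym (Σ<-reindex b (λ i → (a *ℕ i) % b) (pow R x) (λ _ → m%n<n _ b) (coprime⇒*-%-injective cop)))
                  (*-distribˡ-Σ< _ b Sᵢ) ⟩
      Σ< R b (λ i → pow R x ((a *ℕ i) % b)) + Σ< R b (λ i → (pow R x b - 1#) * Sᵢ i)
        ≈⟨ Σ<-distrib-+ b _ _ ⟨
      Σ< R b (λ i → pow R x ((a *ℕ i) % b) + (pow R x b - 1#) * Sᵢ i)
        ≈⟨ Σ<-cong b (λ i → x^n≈x^[n%b]+[x^b-1]*Σ x b (a *ℕ i)) ⟩
      Σ< R b (λ i → pow R x (a *ℕ i))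
        ∎

theorem1 : ∀ {c ℓ} (R : CommutativeRing c ℓ) (a b : ℕ) (0<a : 0 < a) (0<b : 0 < b) →
    Coprime a b → b < a → (x : CommutativeRing.Carrier R) →
    let open CommutativeRing R in
    pow R x (a *ℕ b) - 1#
      ≈ ((pow R x a - 1#) * Σ< R b (λ i → pow R x i))
        * (1# + (x - 1#) * Σ< R b (λ i →
             Σ< R (_/ℕ_ (a *ℕ i) b {{>-nonZero 0<b}}) (λ k →
               pow R x ((a *ℕ i) ∸ (b *ℕ suc k)))))
theorem1 R a b _ 0<b cop _ x = x^ab-1-factorisation R x a b {{>-nonZero 0<b}} cop
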